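{- Let $h(x)=\sum_{k\ge1}h_kx^k\in\mathbb{K}[[x]]$ with $h_k\ne0$ for all $k\ge1$, let $f,r\in\mathbb{K}[[x]]$ and $y_0\in\mathbb{K}$. Then the problem $\mathcal{D}_h(y)=f(\mathcal{I}_h)(y)+r$, $y(0)=y_0$, has a unique solution, given by $$y=\frac{1}{1-xf}(\mathcal{I}_h)\big(y_0+\mathcal{I}_h(r)\big).$$
   Context: $\mathbb{K}$ is a field of characteristic zero. The $h$-derivative is $\mathcal{D}_h\big(\sum_{k\ge0}s_kx^k\big)=\sum_{k\ge1}h_ks_kx^{k-1}$ and the $h$-integral is $\mathcal{I}_h\big(\sum_{k\ge0}s_kx^k\big)=\sum_{k\ge0}\frac{s_k}{h_{k+1}}x^{k+1}$. For a power series $g=\sum_n g_nx^n$, $g(\mathcal{I}_h)$ denotes the operator $\sum_{n\ge0}g_n\mathcal{I}_h^n$ (with $\mathcal{I}_h^0$ the identity), the series converging in the ultrametric $d(u,v)=2^{ -\omega(u-v)}$, $\omega$ the order of a series. Here $\frac{1}{1-xf}$ is the inverse of $1-xf$ in $\mathbb{K}[[x]]$. -}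

module Defs where

open import Level using (_⊔_) renaming (suc to lsuc)
open import Data.Nat using (ℕ; zero; suc; _∸_)
open import Data.Product using (_×_)
open import Relation.Nullary using (¬_)
open import Relation.Binary.PropositionalEquality using (_≡_)
open import Algebra.Bundles using (CommutativeRing)

record Field c ℓ : Set (lsuc (c ⊔ ℓ)) where
  field
    commutativeRing : CommutativeRing c ℓ
  open CommutativeRing commutativeRing public
  field
    0≉1   : ¬ (0# ≈ 1#)
    inv   : (x : Carrier) → ¬ (x ≈ 0#) → Carrier
    inv-r : (x : Carrier) (p : ¬ (x ≈ 0#)) → x * inv x p ≈ 1#

module FieldOps {c ℓ} (K : Field c ℓ) where
  open Field K

  fromℕ : ℕ → Carrier
  fromℕ zero    = 0#
  fromℕ (suc n) = 1# + fromℕ n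

  CharZero : Set ℓ
  CharZero = ∀ n → ¬ (fromℕ (suc n) ≈ 0#)

module SeriesOps {c ℓ} (K : Field c ℓ) where
  open Field K

  Series : Set c
  Series = ℕ → Carrier

  _≈ₛ_ : Series → Series → Set ℓ
  s ≈ₛ t = ∀ n → s n ≈ t n

  _+ₛ_ : Series → Series → Series
  (s +ₛ t) n = s n + t n

  _-ₛ_ : Series → Series → Series
  (s -ₛ t) n = s n + (- t n)

  sumTo : ℕ → (ℕ → Carrier) → Carrier
  sumTo zero    u = u 0
  sumTo (suc n) u = sumTo n u + u (suc n)

  _⋆_ : Series → Series → Series
  (s ⋆ t) n = sumTo n (λ k → s k * t (n ∸ k))

  const : Carrier → Series
  const a zero    = a
  const a (suc n) = 0#

  oneₛ : Series
  oneₛ = const 1#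

  xmul : Series → Series
  xmul s zero    = 0#
  xmul s (suc n) = s n

  module HOps (h : Series) (hnz : ∀ k → ¬ (h (suc k) ≈ 0#)) where

    Dh : Series → Series
    Dh s n = h (suc n) * s (suc n)

    Ih : Series → Series
    Ih s zero    = 0#
    Ih s (suc n) = s n * inv (h (suc n)) (hnz n)

    Ihpow : ℕ → Series → Series
    Ihpow zero    s = s
    Ihpow (suc m) s = Ih (Ihpow m s)

    -- g(I_h)(s) = Σ_m g_m I_h^m(s), the ultrametric limit of partial sums.
    -- Since ω(I_h^m s) ≥ m, the x^n coefficient of the limit is the
    -- x^n coefficient of the n-th partial sum.
    evalOp : Series → Series → Series
    evalOp g s n = sumTo n (λ m → g m * Ihpow m s n)

    IsSolution : Series → Series → Carrier → Series → Set ℓ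
    IsSolution f r y0 y = (Dh y ≈ₛ (evalOp f y +ₛ r)) × (y 0 ≈ y0)

{-# OPTIONS --safe #-}
-- Since I_h raises the order of a series, the x^n coefficient of f(I_h)(y)
-- involves only y_0, …, y_n, so the equation determines y_{n+1} from the lower
-- coefficients; this gives uniqueness. For existence, g = 1/(1 - x f) satisfies
-- g_0 = 1 and (g - g_0)/x = f g. The operator identities
-- g(I_h) = g_0 + I_h ∘ ((g - g_0)/x)(I_h) and f(I_h) ∘ g(I_h) = (f g)(I_h),
-- together with D_h ∘ I_h = id, give for s = y_0 + I_h(r)
-- D_h(g(I_h) s) = D_h s + (f g)(I_h) s = r + f(I_h)(g(I_h) s).
module Submission where

open import Defs
open import Data.Nat using (ℕ; zero; suc; _≤_; s≤s)
open import Data.Nat.Properties using (≤-refl; ≤-trans; n≤1+n)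
open import Data.Product using (_×_; _,_)
open import Relation.Nullary using (¬_)
open import Algebra.Bundles using (Semiring)
import Algebra.Properties.CommutativeSemigroup as CommutativeSemigroupProperties
import Algebra.Properties.Ring as RingProperties
import Relation.Binary.Reasoning.Setoid as SetoidReasoning

module SemiringLemmas {c ℓ} (R : Semiring c ℓ) where
  open Semiring R
  open SetoidReasoning setoid

  a[bx+cy]+dy≈abx+[ac+d]y : ∀ a b x c d y →
    a * (b * x + c * y) + d * y ≈ (a * b) * x + (a * c + d) * y
  a[bx+cy]+dy≈abx+[ac+d]y a b x c d y = begin
    a * (b * x + c * y) + d * y          ≈⟨ +-congʳ (distribˡ a _ _) ⟩
    (a * (b * x) + a * (c * y)) + d * y
      ≈⟨ +-congʳ (+-cong (*-assoc a b x) (*-assoc a c y)) ⟨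
    ((a * b) * x + (a * c) * y) + d * y  ≈⟨ +-assoc _ _ _ ⟩
    (a * b) * x + ((a * c) * y + d * y)  ≈⟨ +-congˡ (distribʳ y _ _) ⟨
    (a * b) * x + (a * c + d) * y        ∎

module FieldLemmas {c ℓ} (K : Field c ℓ) where
  open Field K
  open SetoidReasoning setoid
  open CommutativeSemigroupProperties *-commutativeSemigroup using (x∙yz≈y∙xz)

  x[yx⁻¹]≈y : ∀ x (x≉0 : ¬ x ≈ 0#) y → x * (y * inv x x≉0) ≈ y
  x[yx⁻¹]≈y x x≉0 y = begin
    x * (y * inv x x≉0)  ≈⟨ x∙yz≈y∙xz x y _ ⟩
    y * (x * inv x x≉0)  ≈⟨ *-congˡ (inv-r x x≉0) ⟩
    y * 1#               ≈⟨ *-identityʳ y ⟩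
    y                    ∎

  *-cancelˡ-≉0 : ∀ x (x≉0 : ¬ x ≈ 0#) {y z} → x * y ≈ x * z → y ≈ z
  *-cancelˡ-≉0 x x≉0 {y} {z} xy≈xz = begin
    y                    ≈⟨ x[yx⁻¹]≈y x x≉0 y ⟨
    x * (y * inv x x≉0)  ≈⟨ *-assoc x y _ ⟨
    (x * y) * inv x x≉0  ≈⟨ *-congʳ xy≈xz ⟩
    (x * z) * inv x x≉0  ≈⟨ *-assoc x z _ ⟩
    x * (z * inv x x≉0)  ≈⟨ x[yx⁻¹]≈y x x≉0 z ⟩
    z                    ∎

module SeriesLemmas {c ℓ} (K : Field c ℓ) where
  open Field K
  open SeriesOps K
  open SetoidReasoning setoid
  open RingProperties ring using (-0#≈0#; -‿distribˡ-*; -‿+-comm; x∙y⁻¹≈ε⇒x≈y)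
  open CommutativeSemigroupProperties +-commutativeSemigroup using (interchange)

  shiftₛ : Series → Series
  shiftₛ s n = s (suc n)

  sumTo-cong : ∀ n {u v : ℕ → Carrier} → (∀ i → u i ≈ v i) → sumTo n u ≈ sumTo n v
  sumTo-cong zero    u≈v = u≈v 0
  sumTo-cong (suc n) u≈v = +-cong (sumTo-cong n u≈v) (u≈v (suc n))

  sumTo-+ : ∀ n (u v : ℕ → Carrier) → sumTo n (λ i → u i + v i) ≈ sumTo n u + sumTo n v
  sumTo-+ zero    u v = refl
  sumTo-+ (suc n) u v = trans (+-congʳ (sumTo-+ n u v)) (interchange _ _ _ _)

  sumTo-*ˡ : ∀ n a (u : ℕ → Carrier) → sumTo n (λ i → a * u i) ≈ a * sumTo n u
  sumTo-*ˡ zero    a u = refl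
  sumTo-*ˡ (suc n) a u = trans (+-congʳ (sumTo-*ˡ n a u)) (sym (distribˡ a _ _))

  sumTo-*ʳ : ∀ n a (u : ℕ → Carrier) → sumTo n (λ i → u i * a) ≈ sumTo n u * a
  sumTo-*ʳ zero    a u = refl
  sumTo-*ʳ (suc n) a u = trans (+-congʳ (sumTo-*ʳ n a u)) (sym (distribʳ a _ _))

  sumTo-neg : ∀ n (u : ℕ → Carrier) → sumTo n (λ i → - u i) ≈ - sumTo n u
  sumTo-neg zero    u = refl
  sumTo-neg (suc n) u = trans (+-congʳ (sumTo-neg n u)) (-‿+-comm _ _)

  sumTo-suc-head : ∀ n (u : ℕ → Carrier) → sumTo (suc n) u ≈ u 0 + sumTo n (λ i → u (suc i))
  sumTo-suc-head zero    u = refl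
  sumTo-suc-head (suc n) u = trans (+-congʳ (sumTo-suc-head n u)) (+-assoc _ _ _)

  ⋆-suc : ∀ a b k → (a ⋆ b) (suc k) ≈ a 0 * b (suc k) + (shiftₛ a ⋆ b) k
  ⋆-suc a b k = sumTo-suc-head k _

  ⋆-congˡ : ∀ {a a′} b → a ≈ₛ a′ → (a ⋆ b) ≈ₛ (a′ ⋆ b)
  ⋆-congˡ b a≈a′ n = sumTo-cong n (λ i → *-congʳ (a≈a′ i))

  ⋆-negˡ : ∀ a b n → ((λ i → - a i) ⋆ b) n ≈ - (a ⋆ b) n
  ⋆-negˡ a b n = trans (sumTo-cong n (λ i → sym (-‿distribˡ-* _ _))) (sumTo-neg n _)

  1/[1-xf]-recurrence : ∀ f g → ((oneₛ -ₛ xmul f) ⋆ g) ≈ₛ oneₛ →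
                        g 0 ≈ 1# × shiftₛ g ≈ₛ (f ⋆ g)
  1/[1-xf]-recurrence f g [1-xf]g≈1 = g₀≈1 , shiftg≈fg
    where
      1-0≈1 : 1# + - 0# ≈ 1#
      1-0≈1 = trans (+-congˡ -0#≈0#) (+-identityʳ 1#)

      [1-0]x≈x : ∀ x → (1# + - 0#) * x ≈ x
      [1-0]x≈x x = trans (*-congʳ 1-0≈1) (*-identityˡ x)

      shift[1-xf]≈-f : shiftₛ (oneₛ -ₛ xmul f) ≈ₛ (λ i → - f i)
      shift[1-xf]≈-f i = +-identityˡ (- f i)

      g₀≈1 : g 0 ≈ 1#
      g₀≈1 = trans (sym ([1-0]x≈x (g 0))) ([1-xf]g≈1 0)

      shiftg≈fg : shiftₛ g ≈ₛ (f ⋆ g)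
      shiftg≈fg k = x∙y⁻¹≈ε⇒x≈y _ _ (begin
        g (suc k) + - (f ⋆ g) k
          ≈⟨ +-cong ([1-0]x≈x _) (trans (⋆-congˡ g shift[1-xf]≈-f k) (⋆-negˡ f g k)) ⟨
        (1# + - 0#) * g (suc k) + (shiftₛ (oneₛ -ₛ xmul f) ⋆ g) k
          ≈⟨ ⋆-suc (oneₛ -ₛ xmul f) g k ⟨
        ((oneₛ -ₛ xmul f) ⋆ g) (suc k)
          ≈⟨ [1-xf]g≈1 (suc k) ⟩
        0# ∎)

module HCalculus {c ℓ} (K : Field c ℓ) where
  open Field K
  open SeriesOps K

  module _ (h : Series) (hnz : ∀ k → ¬ (h (suc k) ≈ 0#)) where
    open HOps h hnz
    open FieldLemmas K
    open SeriesLemmas K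
    open SemiringLemmas semiring using (a[bx+cy]+dy≈abx+[ac+d]y)
    open SetoidReasoning setoid
    open CommutativeSemigroupProperties *-commutativeSemigroup using (x∙yz≈y∙xz)

    h⁻¹ : ℕ → Carrier
    h⁻¹ k = inv (h (suc k)) (hnz k)

    Dh-Ih : ∀ u → Dh (Ih u) ≈ₛ u
    Dh-Ih u n = x[yx⁻¹]≈y (h (suc n)) (hnz n) (u n)

    Dh-const-+ : ∀ a u → Dh (const a +ₛ u) ≈ₛ Dh u
    Dh-const-+ a u n = *-congˡ (+-identityˡ (u (suc n)))

    Dh-cancel : ∀ {y z} n → Dh y n ≈ Dh z n → y (suc n) ≈ z (suc n)
    Dh-cancel n = *-cancelˡ-≉0 (h (suc n)) (hnz n)

    evalOp-suc : ∀ g s n →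
                 evalOp g s (suc n) ≈ g 0 * s (suc n) + Ih (evalOp (shiftₛ g) s) (suc n)
    evalOp-suc g s n = trans (sumTo-suc-head n _)
      (+-congˡ (trans (sumTo-cong n (λ m → sym (*-assoc _ _ _))) (sumTo-*ʳ n (h⁻¹ n) _)))

    evalOp-congˡ : ∀ {a b} → a ≈ₛ b → ∀ s → evalOp a s ≈ₛ evalOp b s
    evalOp-congˡ a≈b s n = sumTo-cong n (λ m → *-congʳ (a≈b m))

    evalOp-+ˡ : ∀ a b s n → evalOp (a +ₛ b) s n ≈ evalOp a s n + evalOp b s n
    evalOp-+ˡ a b s n = trans (sumTo-cong n (λ m → distribʳ _ _ _)) (sumTo-+ n _ _)

    evalOp-*ˡ : ∀ x a s n → evalOp (λ m → x * a m) s n ≈ x * evalOp a s n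
    evalOp-*ˡ x a s n = trans (sumTo-cong n (λ m → *-assoc _ _ _)) (sumTo-*ˡ n x _)

    evalOp-∘ : ∀ f g s → evalOp f (evalOp g s) ≈ₛ evalOp (f ⋆ g) s
    evalOp-∘ f g s zero    = sym (*-assoc _ _ _)
    evalOp-∘ f g s (suc n) = begin
      evalOp f (evalOp g s) (suc n)
        ≈⟨ evalOp-suc f (evalOp g s) n ⟩
      f 0 * evalOp g s (suc n) + evalOp (shiftₛ f) (evalOp g s) n * h⁻¹ n
        ≈⟨ +-cong (*-congˡ (evalOp-suc g s n)) (*-congʳ (evalOp-∘ (shiftₛ f) g s n)) ⟩
      f 0 * (g 0 * s (suc n) + evalOp (shiftₛ g) s n * h⁻¹ n) + evalOp (shiftₛ f ⋆ g) s n * h⁻¹ n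
        ≈⟨ a[bx+cy]+dy≈abx+[ac+d]y _ _ _ _ _ _ ⟩
      (f 0 * g 0) * s (suc n) + (f 0 * evalOp (shiftₛ g) s n + evalOp (shiftₛ f ⋆ g) s n) * h⁻¹ n
        ≈⟨ +-congˡ (*-congʳ shift[fg]) ⟨
      (f ⋆ g) 0 * s (suc n) + evalOp (shiftₛ (f ⋆ g)) s n * h⁻¹ n
        ≈⟨ evalOp-suc (f ⋆ g) s n ⟨
      evalOp (f ⋆ g) s (suc n) ∎
      where
        shift[fg] : evalOp (shiftₛ (f ⋆ g)) s n
                  ≈ f 0 * evalOp (shiftₛ g) s n + evalOp (shiftₛ f ⋆ g) s n
        shift[fg] = begin
          evalOp (shiftₛ (f ⋆ g)) s n
            ≈⟨ evalOp-congˡ (⋆-suc f g) s n ⟩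
          evalOp ((λ m → f 0 * g (suc m)) +ₛ (shiftₛ f ⋆ g)) s n
            ≈⟨ evalOp-+ˡ _ _ s n ⟩
          evalOp (λ m → f 0 * g (suc m)) s n + evalOp (shiftₛ f ⋆ g) s n
            ≈⟨ +-congʳ (evalOp-*ˡ (f 0) (shiftₛ g) s n) ⟩
          f 0 * evalOp (shiftₛ g) s n + evalOp (shiftₛ f ⋆ g) s n ∎

    evalOp-local : ∀ f {y z} n → (∀ j → j ≤ n → y j ≈ z j) → evalOp f y n ≈ evalOp f z n
    evalOp-local f         zero    y≈z = *-congˡ (y≈z 0 ≤-refl)
    evalOp-local f {y} {z} (suc n) y≈z = begin
      evalOp f y (suc n)                                   ≈⟨ evalOp-suc f y n ⟩
      f 0 * y (suc n) + evalOp (shiftₛ f) y n * h⁻¹ n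
        ≈⟨ +-cong (*-congˡ (y≈z (suc n) ≤-refl)) (*-congʳ (evalOp-local (shiftₛ f) n y≈z↾n)) ⟩
      f 0 * z (suc n) + evalOp (shiftₛ f) z n * h⁻¹ n      ≈⟨ evalOp-suc f z n ⟨
      evalOp f z (suc n)                                   ∎
      where
        y≈z↾n : ∀ j → j ≤ n → y j ≈ z j
        y≈z↾n j j≤n = y≈z j (≤-trans j≤n (n≤1+n n))

    Dh-evalOp : ∀ g s n → Dh (evalOp g s) n ≈ g 0 * Dh s n + evalOp (shiftₛ g) s n
    Dh-evalOp g s n = begin
      h (suc n) * evalOp g s (suc n)
        ≈⟨ *-congˡ (evalOp-suc g s n) ⟩
      h (suc n) * (g 0 * s (suc n) + Ih (evalOp (shiftₛ g) s) (suc n))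
        ≈⟨ distribˡ _ _ _ ⟩
      h (suc n) * (g 0 * s (suc n)) + Dh (Ih (evalOp (shiftₛ g) s)) n
        ≈⟨ +-cong (x∙yz≈y∙xz _ _ _) (Dh-Ih (evalOp (shiftₛ g) s) n) ⟩
      g 0 * Dh s n + evalOp (shiftₛ g) s n ∎

    solution-exists : ∀ f r y0 g → g 0 ≈ 1# → shiftₛ g ≈ₛ (f ⋆ g) →
                      IsSolution f r y0 (evalOp g (const y0 +ₛ Ih r))
    solution-exists f r y0 g g₀≈1 shiftg≈fg = solves , initial
      where
        s y : Series
        s = const y0 +ₛ Ih r
        y = evalOp g s

        Ds≈r : Dh s ≈ₛ r
        Ds≈r n = trans (Dh-const-+ y0 (Ih r) n) (Dh-Ih r n)

        solves : Dh y ≈ₛ (evalOp f y +ₛ r)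
        solves n = begin
          Dh y n                                  ≈⟨ Dh-evalOp g s n ⟩
          g 0 * Dh s n + evalOp (shiftₛ g) s n
            ≈⟨ +-cong (*-cong g₀≈1 (Ds≈r n)) (evalOp-congˡ shiftg≈fg s n) ⟩
          1# * r n + evalOp (f ⋆ g) s n
            ≈⟨ +-cong (*-identityˡ (r n)) (sym (evalOp-∘ f g s n)) ⟩
          r n + evalOp f y n                      ≈⟨ +-comm _ _ ⟩
          evalOp f y n + r n                      ∎

        initial : y 0 ≈ y0
        initial = trans (*-cong g₀≈1 (+-identityʳ y0)) (*-identityˡ y0)

    solutions-agree-upTo : ∀ {f r y0 y z} → IsSolution f r y0 y → IsSolution f r y0 z →
                           ∀ n j → j ≤ n → y j ≈ z j
    solutions-agree-upTo (_ , y₀≈) (_ , z₀≈) n zero _ = trans y₀≈ (sym z₀≈)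
    solutions-agree-upTo {f} {r} {y = y} {z} sol-y@(Dy≈ , _) sol-z@(Dz≈ , _)
                         (suc n) (suc j) (s≤s j≤n) =
      Dh-cancel {y} {z} j (begin
        Dh y j              ≈⟨ Dy≈ j ⟩
        evalOp f y j + r j  ≈⟨ +-congʳ (evalOp-local f j agree) ⟩
        evalOp f z j + r j  ≈⟨ Dz≈ j ⟨
        Dh z j              ∎)
      where
        agree : ∀ i → i ≤ j → y i ≈ z i
        agree i i≤j = solutions-agree-upTo sol-y sol-z n i (≤-trans i≤j j≤n)

    solution-unique : ∀ {f r y0 y z} → IsSolution f r y0 y → IsSolution f r y0 z → y ≈ₛ z
    solution-unique sol-y sol-z n = solutions-agree-upTo sol-y sol-z n n ≤-refl

mainTheorem6 : ∀ {c ℓ} (K : Field c ℓ) →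
    let open Field K
        open FieldOps K
        open SeriesOps K
    in CharZero →
       (h : Series) → h 0 ≈ 0# → (hnz : ∀ k → ¬ (h (suc k) ≈ 0#)) →
       (f r : Series) (y0 : Carrier) →
       -- g is the inverse 1/(1 - x f) of 1 - x f in K[[x]]
       (g : Series) → ((oneₛ -ₛ xmul f) ⋆ g) ≈ₛ oneₛ →
       let open HOps h hnz
           ysol = evalOp g (const y0 +ₛ Ih r)
       in IsSolution f r y0 ysol × (∀ y → IsSolution f r y0 y → y ≈ₛ ysol)
mainTheorem6 K _ h _ hnz f r y0 g [1-xf]g≈1 =
  solution , λ y sol-y → solution-unique h hnz sol-y solution
  where
    open SeriesOps K
    open HOps h hnz
    open SeriesLemmas K using (1/[1-xf]-recurrence)
    open HCalculus K using (solution-exists; solution-unique)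

    solution : IsSolution f r y0 (evalOp g (const y0 +ₛ Ih r))
    solution = let g₀≈1 , shiftg≈fg = 1/[1-xf]-recurrence f g [1-xf]g≈1
               in solution-exists h hnz f r y0 g g₀≈1 shiftg≈fg
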